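{- Let $T$ be the theory of structures $(D,R,f)$ with $R$ a reflexive and transitive binary relation and $f$ a unary function which strictly preserves $R$, namely, for all $d,e$: if $d\,R\,e$ and $d\neq e$, then both $f(d)\,R\,f(e)$ and $f(d)\neq f(e)$. Then $T$ does not have the amalgamation property.
   Context: A theory has the amalgamation property (AP) if whenever $\mathbf{A},\mathbf{B},\mathbf{C}$ are models with $\mathbf{C}$ a substructure of both $\mathbf{A}$ and $\mathbf{B}$ (substructures closed under $f$) and $C=A\cap B$, there are a model $\mathbf{D}$ and embeddings of $\mathbf{A}$ and $\mathbf{B}$ into $\mathbf{D}$ that agree on $C$. -}

module Defs where

open import Level using (0ℓ)
open import Data.Product using (Σ; _×_; _,_)
open import Relation.Binary.PropositionalEquality using (_≡_)
open import Relation.Nullary using (¬_)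
open import Function.Definitions using (Injective)

record Model : Set₁ where
  field
    Carrier : Set
    R       : Carrier → Carrier → Set
    f       : Carrier → Carrier
    R-refl  : ∀ d → R d d
    R-trans : ∀ {d e k} → R d e → R e k → R d k
    f-strict : ∀ {d e} → R d e → ¬ (d ≡ e) → R (f d) (f e) × ¬ (f d ≡ f e)

open Model

-- An embedding of structures in the signature {R, f}: an injective map that
-- commutes with f and both preserves and reflects R.
-- (Equivalently: an isomorphism onto a substructure, i.e. a subset closed
-- under f with the induced relation.)
record Embedding (A B : Model) : Set where
  field
    map       : Carrier A → Carrier B
    injective : Injective _≡_ _≡_ map
    map-f     : ∀ d → map (f A d) ≡ f B (map d)
    map-R     : ∀ {d e} → R A d e → R B (map d) (map e)
    map-R⁻¹   : ∀ {d e} → R B (map d) (map e) → R A d e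

open Embedding

-- Amalgamation property for T.  A common substructure C of A and B with
-- C = A ∩ B is represented (up to renaming of elements) by a model C
-- together with embeddings C → A and C → B.
AmalgamationProperty : Set₁
AmalgamationProperty =
  (A B C : Model) (i : Embedding C A) (j : Embedding C B) →
  Σ Model λ D → Σ (Embedding A D) λ g → Σ (Embedding B D) λ h →
    ∀ c → map g (map i c) ≡ map h (map j c)

{-# OPTIONS --safe #-}
-- Take C = ℕ with the total relation and f = suc, and extend it in two ways by a
-- new point sent to 0: A adjoins a least point u, B a greatest point v.  In any
-- amalgam u R 0 R v, and u ≠ v because 0 is not below u in A; strictness then
-- forces f u ≠ f v, although both are the image of 0 ∈ C.
module Submission where

open import Defs
open import Data.Empty using (⊥)
open import Data.Maybe using (Maybe; just; nothing)
open import Data.Maybe.Properties using (just-injective)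
open import Data.Nat using (ℕ; zero; suc)
open import Data.Nat.Properties using (suc-injective)
open import Data.Product using (Σ; _,_)
open import Data.Unit using (⊤; tt)
open import Function using (_∘_; flip)
open import Relation.Binary.PropositionalEquality using (_≡_; refl; sym; cong; subst)
open Relation.Binary.PropositionalEquality.≡-Reasoning
open import Relation.Nullary using (¬_)

open Model
open Embedding

Amalgam : {A B C : Model} → Embedding C A → Embedding C B → Set₁
Amalgam {A} {B} i j =
  Σ Model λ D → Σ (Embedding A D) λ g → Σ (Embedding B D) λ h →
    ∀ c → map g (map i c) ≡ map h (map j c)

no-amalgam : {A B C : Model} (i : Embedding C A) (j : Embedding C B)
  {u : Carrier A} {v : Carrier B} {c : Carrier C} →
  R A u (map i c) → R B (map j c) v → ¬ R A (map i c) u →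
  f A u ≡ map i c → f B v ≡ map j c →
  ¬ Amalgam i j
no-amalgam {A} {B} i j {u} {v} {c} u≤c c≤v c≰u fu≡c fv≡c (D , g , h , agree) =
  fgu≢fhv fgu≡fhv
  where
  c≤hv : R D (map g (map i c)) (map h v)
  c≤hv = subst (λ x → R D x (map h v)) (sym (agree c)) (map-R h c≤v)

  gu≢hv : ¬ map g u ≡ map h v
  gu≢hv gu≡hv = c≰u (map-R⁻¹ g (subst (R D (map g (map i c))) (sym gu≡hv) c≤hv))

  fgu≢fhv : ¬ f D (map g u) ≡ f D (map h v)
  fgu≢fhv with f-strict D (R-trans D (map-R g u≤c) c≤hv) gu≢hv
  ... | _ , ≢ = ≢

  fgu≡fhv : f D (map g u) ≡ f D (map h v)
  fgu≡fhv = begin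
    f D (map g u)       ≡⟨ sym (map-f g u) ⟩
    map g (f A u)       ≡⟨ cong (map g) fu≡c ⟩
    map g (map i c)     ≡⟨ agree c ⟩
    map h (map j c)     ≡⟨ cong (map h) (sym fv≡c) ⟩
    map h (f B v)       ≡⟨ map-f h v ⟩
    f D (map h v)       ∎

opposite : Model → Model
Carrier  (opposite M) = Carrier M
R        (opposite M) = flip (R M)
f        (opposite M) = f M
R-refl   (opposite M) = R-refl M
R-trans  (opposite M) e≥d k≥e = R-trans M k≥e e≥d
f-strict (opposite M) e≤d d≢e with f-strict M e≤d (d≢e ∘ sym)
... | fe≤fd , fe≢fd = fe≤fd , fe≢fd ∘ sym

ℕ-chaotic : Model
Carrier  ℕ-chaotic = ℕ
R        ℕ-chaotic _ _ = ⊤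
f        ℕ-chaotic = suc
R-refl   ℕ-chaotic _ = tt
R-trans  ℕ-chaotic _ _ = tt
f-strict ℕ-chaotic _ d≢e = tt , d≢e ∘ suc-injective

_≤⊥_ : Maybe ℕ → Maybe ℕ → Set
nothing ≤⊥ _       = ⊤
just _  ≤⊥ nothing = ⊥
just _  ≤⊥ just _  = ⊤

≤⊥-trans : ∀ {d e k} → d ≤⊥ e → e ≤⊥ k → d ≤⊥ k
≤⊥-trans {nothing}                     _ _ = tt
≤⊥-trans {just _} {just _} {just _}    _ _ = tt

shift : Maybe ℕ → ℕ
shift nothing  = zero
shift (just n) = suc n

shift-injective : ∀ {d e} → shift d ≡ shift e → d ≡ e
shift-injective {nothing} {nothing} _  = refl
shift-injective {just _}  {just _}  eq = cong just (suc-injective eq)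

ℕ-withBottom : Model
Carrier  ℕ-withBottom = Maybe ℕ
R        ℕ-withBottom = _≤⊥_
f        ℕ-withBottom = just ∘ shift
R-refl   ℕ-withBottom nothing  = tt
R-refl   ℕ-withBottom (just _) = tt
R-trans  ℕ-withBottom = ≤⊥-trans
f-strict ℕ-withBottom _ d≢e = tt , d≢e ∘ shift-injective ∘ just-injective

ℕ-withTop : Model
ℕ-withTop = opposite ℕ-withBottom

just-withBottom : Embedding ℕ-chaotic ℕ-withBottom
map       just-withBottom = just
injective just-withBottom = just-injective
map-f     just-withBottom _ = refl
map-R     just-withBottom _ = tt
map-R⁻¹   just-withBottom _ = tt

just-withTop : Embedding ℕ-chaotic ℕ-withTop
map       just-withTop = just
injective just-withTop = just-injective
map-f     just-withTop _ = refl
map-R     just-withTop _ = tt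
map-R⁻¹   just-withTop _ = tt

proposition4p2 : ¬ AmalgamationProperty
proposition4p2 ap =
  no-amalgam just-withBottom just-withTop {nothing} {nothing} {zero}
    tt tt (λ ()) refl refl
    (ap ℕ-withBottom ℕ-withTop ℕ-chaotic just-withBottom just-withTop)
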